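{- Let $\mathcal{G}$ be a class of graphs that is $\chi$-bounded by a non-decreasing function $f:\mathbb{N}\rightarrow\mathbb{R}$. Then the class $\mathcal{G}^*$ is $\chi$-bounded by the function $g(k)=f(k)^k$.
   Context: All graphs are finite and simple, possibly empty; $\omega$ is the clique number and $\chi$ the chromatic number (both $0$ for the empty graph); $f(0)^0=1$. A class $\mathcal{G}$ is $\chi$-bounded by $f$ if for all $G\in\mathcal{G}$ and all (possibly empty) induced subgraphs $H$ of $G$, $\chi(H)\leq f(\omega(H))$. Given non-empty graphs $G_1,G_2$ with disjoint vertex sets and $u\in V_{G_1}$, the graph obtained by substituting $G_2$ for $u$ in $G_1$ has vertex set $(V_{G_1}\smallsetminus\{u\})\cup V_{G_2}$, induces $G_1\smallsetminus u$ and $G_2$ on the respective parts, and each $v\in V_{G_1}\smallsetminus\{u\}$ is complete to $V_{G_2}$ if $v$ is adjacent to $u$ in $G_1$ and anti-complete to $V_{G_2}$ otherwise. $\mathcal{G}^*$ denotes the closure of $\mathcal{G}$ under taking disjoint unions and substitution.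
   Formalization: The non-decreasing function f takes rational values instead of real ones. -}

module Defs where

open import Data.Bool using (Bool; true; false)
open import Data.Nat using (ℕ; zero; suc; _+_)
import Data.Nat as ℕ
open import Data.Fin using (Fin; splitAt; punchIn)
open import Data.Sum using (_⊎_; inj₁; inj₂)
open import Data.Product using (Σ; _×_; _,_; ∃)
open import Data.Rational using (ℚ; 1ℚ; _*_; _≤_; _/_)
open import Data.Integer using (+_)
open import Function.Definitions using (Injective)
open import Relation.Binary.PropositionalEquality using (_≡_; _≢_; refl)
open import Relation.Nullary using (¬_)

record Graph (n : ℕ) : Set where
  field
    adj    : Fin n → Fin n → Bool
    sym    : ∀ i j → adj i j ≡ adj j i
    irrefl : ∀ i → adj i i ≡ false
open Graph public

Class : Set₁
Class = ∀ {n} → Graph n → Set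

InducedSub : ∀ {m n} → Graph m → Graph n → Set
InducedSub {m} {n} H G =
  Σ (Fin m → Fin n) λ ι → Injective _≡_ _≡_ ι ×
    (∀ i j → adj H i j ≡ adj G (ι i) (ι j))

HasClique : ∀ {n} → Graph n → ℕ → Set
HasClique {n} G k =
  Σ (Fin k → Fin n) λ ι → Injective _≡_ _≡_ ι ×
    (∀ i j → i ≢ j → adj G (ι i) (ι j) ≡ true)

IsCliqueNumber : ∀ {n} → Graph n → ℕ → Set
IsCliqueNumber G w = HasClique G w × (∀ k → HasClique G k → k ℕ.≤ w)

Colourable : ∀ {n} → Graph n → ℕ → Set
Colourable {n} G k =
  Σ (Fin n → Fin k) λ c → ∀ i j → adj G i j ≡ true → c i ≢ c j

IsChromaticNumber : ∀ {n} → Graph n → ℕ → Set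
IsChromaticNumber G c = Colourable G c × (∀ k → Colourable G k → c ℕ.≤ k)

ℕtoℚ : ℕ → ℚ
ℕtoℚ k = + k / 1

ChiBoundedBy : Class → (ℕ → ℚ) → Set
ChiBoundedBy 𝒢 f =
  ∀ {n} (G : Graph n) → 𝒢 G →
  ∀ {m} (H : Graph m) → InducedSub H G →
  ∀ w c → IsCliqueNumber H w → IsChromaticNumber H c →
  ℕtoℚ c ≤ f w

NonDecreasing : (ℕ → ℚ) → Set
NonDecreasing f = ∀ i j → i ℕ.≤ j → f i ≤ f j

infixr 8 _^_
_^_ : ℚ → ℕ → ℚ
q ^ zero  = 1ℚ
q ^ suc k = q * (q ^ k)

mkSumGraph : ∀ n m (A : Fin n ⊎ Fin m → Fin n ⊎ Fin m → Bool) →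
  (∀ x y → A x y ≡ A y x) → (∀ x → A x x ≡ false) → Graph (n + m)
mkSumGraph n m A s r = record
  { adj    = λ i j → A (splitAt n i) (splitAt n j)
  ; sym    = λ i j → s (splitAt n i) (splitAt n j)
  ; irrefl = λ i → r (splitAt n i)
  }

unionAdj : ∀ {n m} → Graph n → Graph m → Fin n ⊎ Fin m → Fin n ⊎ Fin m → Bool
unionAdj G H (inj₁ a) (inj₁ b) = adj G a b
unionAdj G H (inj₁ a) (inj₂ b) = false
unionAdj G H (inj₂ a) (inj₁ b) = false
unionAdj G H (inj₂ a) (inj₂ b) = adj H a b

unionSym : ∀ {n m} (G : Graph n) (H : Graph m) x y → unionAdj G H x y ≡ unionAdj G H y x
unionSym G H (inj₁ a) (inj₁ b) = sym G a b
unionSym G H (inj₁ a) (inj₂ b) = refl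
unionSym G H (inj₂ a) (inj₁ b) = refl
unionSym G H (inj₂ a) (inj₂ b) = sym H a b

unionIrr : ∀ {n m} (G : Graph n) (H : Graph m) x → unionAdj G H x x ≡ false
unionIrr G H (inj₁ a) = irrefl G a
unionIrr G H (inj₂ a) = irrefl H a

disjointUnion : ∀ {n m} → Graph n → Graph m → Graph (n + m)
disjointUnion {n} {m} G H = mkSumGraph n m (unionAdj G H) (unionSym G H) (unionIrr G H)

-- substitution of G₂ for the vertex u of G₁ (both non-empty).
-- Vertices of G₁ other than u are punchIn u a for a : Fin k.
substAdj : ∀ {k m} → Graph (suc k) → Fin (suc k) → Graph m →
  Fin k ⊎ Fin m → Fin k ⊎ Fin m → Bool
substAdj G₁ u G₂ (inj₁ a) (inj₁ b) = adj G₁ (punchIn u a) (punchIn u b)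
substAdj G₁ u G₂ (inj₁ a) (inj₂ b) = adj G₁ (punchIn u a) u
substAdj G₁ u G₂ (inj₂ a) (inj₁ b) = adj G₁ u (punchIn u b)
substAdj G₁ u G₂ (inj₂ a) (inj₂ b) = adj G₂ a b

substSym : ∀ {k m} (G₁ : Graph (suc k)) u (G₂ : Graph m) x y →
  substAdj G₁ u G₂ x y ≡ substAdj G₁ u G₂ y x
substSym G₁ u G₂ (inj₁ a) (inj₁ b) = sym G₁ _ _
substSym G₁ u G₂ (inj₁ a) (inj₂ b) = sym G₁ _ _
substSym G₁ u G₂ (inj₂ a) (inj₁ b) = sym G₁ _ _
substSym G₁ u G₂ (inj₂ a) (inj₂ b) = sym G₂ a b

substIrr : ∀ {k m} (G₁ : Graph (suc k)) u (G₂ : Graph m) x →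
  substAdj G₁ u G₂ x x ≡ false
substIrr G₁ u G₂ (inj₁ a) = irrefl G₁ _
substIrr G₁ u G₂ (inj₂ a) = irrefl G₂ a

substitute : ∀ {k m} → Graph (suc k) → Fin (suc k) → Graph (suc m) → Graph (k + suc m)
substitute {k} {m} G₁ u G₂ =
  mkSumGraph k (suc m) (substAdj G₁ u G₂) (substSym G₁ u G₂) (substIrr G₁ u G₂)

data Closure (𝒢 : Class) : Class where
  base  : ∀ {n} {G : Graph n} → 𝒢 G → Closure 𝒢 G
  union : ∀ {n m} {G : Graph n} {H : Graph m} →
          Closure 𝒢 G → Closure 𝒢 H → Closure 𝒢 (disjointUnion G H)
  subst : ∀ {k m} {G₁ : Graph (suc k)} {G₂ : Graph (suc m)} (u : Fin (suc k)) →
          Closure 𝒢 G₁ → Closure 𝒢 G₂ → Closure 𝒢 (substitute G₁ u G₂)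

{-# OPTIONS --safe #-}
-- Fix w and let N be the largest natural number with N ≤ f(w). Every vertex x of a vertex
-- set P with ω(P) ≤ w in a member of 𝒢* receives a list of colours from Fin N such that
-- adjacent vertices get lists differing at a common position, and the list of x is no
-- longer than some clique of P among the neighbours of x, hence shorter than w. In a
-- member of 𝒢 one proper colouring of P with at most f(ω(P)) ≤ f(w) colours does it; a
-- disjoint union combines the lists of its parts; when G₂ is substituted for u in G₁, a
-- vertex of G₂ gets the list of u (computed in G₁ on P with G₂ contracted to u) followed by
-- its own list in G₂, and the two clique witnesses join into one, since every vertex
-- adjacent to u is complete to G₂. Padding the lists to length w yields a proper colouring
-- with N^w ≤ f(w)^w colours.
module Submission where

open import Defs
open import Data.Nat using (ℕ)
open import Data.Rational using (ℚ)

open import Data.Bool using (Bool; true; false)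
import Data.Bool.Properties as Bool
open import Data.Empty using (⊥-elim)
open import Data.Fin as Fin using (Fin; zero; suc; splitAt; join; punchIn; combine; inject≤)
import Data.Fin.Properties as Fin
open import Data.Integer as ℤ using (+_)
import Data.Integer.Properties as ℤ
open import Data.List using (List; []; _∷_; [_]; _++_; length)
open import Data.List.Properties using (length-++)
open import Data.Nat as ℕ using (zero; suc; _+_; z≤n; s≤s)
import Data.Nat.Properties as ℕ
open import Data.Nat.Coprimality as Coprimality using (1-coprimeTo)
open import Data.Product using (Σ; ∃; ∃-syntax; _×_; _,_; proj₁; proj₂)
import Data.Rational as ℚ
import Data.Rational.Properties as ℚ
open import Data.Sum using (_⊎_; inj₁; inj₂; [_,_]′)
open import Data.Unit using (⊤; tt)
import Data.Vec.Functional as Vector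
open import Function using (_∘_; id)
open import Function.Definitions using (Injective)
open import Relation.Binary.PropositionalEquality as ≡
  using (_≡_; _≢_; _≗_; refl; trans; cong; subst₂)
open import Relation.Nullary using (¬_; Dec; yes; no; contradiction)
open import Relation.Nullary.Decidable using (map′; _×-dec_; _⊎-dec_; _→-dec_; ¬?)
open import Relation.Unary using (Decidable)

ℕtoℚ≡mkℚ : ∀ k → ℕtoℚ k ≡ ℚ.mkℚ (+ k) 0 (Coprimality.sym (1-coprimeTo k))
ℕtoℚ≡mkℚ k = ℚ.normalize-coprime _

ℕtoℚ-* : ∀ a b → ℕtoℚ a ℚ.* ℕtoℚ b ≡ ℕtoℚ (a ℕ.* b)
ℕtoℚ-* a b rewrite ℕtoℚ≡mkℚ a | ℕtoℚ≡mkℚ b = cong (ℚ._/ 1) (≡.sym (ℤ.pos-* a b))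

ℕtoℚ-mono-≤ : ∀ {a b} → a ℕ.≤ b → ℕtoℚ a ℚ.≤ ℕtoℚ b
ℕtoℚ-mono-≤ {a} {b} a≤b rewrite ℕtoℚ≡mkℚ a | ℕtoℚ≡mkℚ b =
  ℚ.*≤* (subst₂ ℤ._≤_ (≡.sym (ℤ.*-identityʳ (+ a))) (≡.sym (ℤ.*-identityʳ (+ b))) (ℤ.+≤+ a≤b))

ℕtoℚ-nonNeg : ∀ k → ℚ.NonNegative (ℕtoℚ k)
ℕtoℚ-nonNeg k = ℚ.nonNegative (ℕtoℚ-mono-≤ {0} {k} z≤n)

ℕtoℚ-^-≤ : ∀ {N q} w → ℕtoℚ N ℚ.≤ q → ℕtoℚ (N ℕ.^ w) ℚ.≤ q ^ w
ℕtoℚ-^-≤ zero N≤q = ℚ.≤-refl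
ℕtoℚ-^-≤ {N} {q} (suc w) N≤q =
  ≡.subst (ℚ._≤ q ^ suc w) (ℕtoℚ-* N (N ℕ.^ w))
    (ℚ.≤-trans (ℚ.*-monoʳ-≤-nonNeg (ℕtoℚ (N ℕ.^ w)) {{ℕtoℚ-nonNeg (N ℕ.^ w)}} N≤q)
               (ℚ.*-monoˡ-≤-nonNeg q {{q-nonNeg}} (ℕtoℚ-^-≤ w N≤q)))
  where
  q-nonNeg : ℚ.NonNegative q
  q-nonNeg = ℚ.nonNegative (ℚ.≤-trans (ℕtoℚ-mono-≤ {0} {N} z≤n) N≤q)

ℕtoℚ-≤-∣numerator∣ : ∀ e q → ℕtoℚ e ℚ.≤ q → e ℕ.≤ ℤ.∣ ℚ.ℚ.numerator q ∣
ℕtoℚ-≤-∣numerator∣ e (ℚ.mkℚ n d _) e≤q rewrite ℕtoℚ≡mkℚ e with e≤q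
... | ℚ.*≤* e*d≤n*1 = ≤-∣n∣ n (subst₂ ℤ._≤_ (≡.sym (ℤ.pos-* e (suc d))) (ℤ.*-identityʳ n) e*d≤n*1)
  where
  ≤-∣n∣ : ∀ n → + (e ℕ.* suc d) ℤ.≤ n → e ℕ.≤ ℤ.∣ n ∣
  ≤-∣n∣ (+ n) e*d≤n = ℕ.≤-trans (ℕ.m≤m*n e (suc d)) (ℤ.drop‿+≤+ e*d≤n)

findGreatest : ∀ {P : ℕ → Set} → Decidable P → ∀ B → P 0 → (∀ k → P k → k ℕ.≤ B) →
  ∃[ n ] P n × (∀ k → P k → k ℕ.≤ n)
findGreatest P? zero p₀ bounded = 0 , p₀ , bounded
findGreatest {P} P? (suc B) p₀ bounded with P? (suc B)
... | yes p = suc B , p , bounded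
... | no ¬p = findGreatest P? B p₀ λ k pk →
  ℕ.≤-pred (ℕ.≤∧≢⇒< (bounded k pk) λ k≡1+B → ¬p (≡.subst P k≡1+B pk))

findLeast : ∀ {P : ℕ → Set} → Decidable P → ∀ B → P B → ∃[ n ] P n × (∀ k → P k → n ℕ.≤ k)
findLeast P? B pB with P? 0
... | yes p₀ = 0 , p₀ , λ _ _ → z≤n
findLeast P? zero pB | no ¬p₀ = contradiction pB ¬p₀
findLeast P? (suc B) pB | no ¬p₀ with findLeast (P? ∘ suc) B pB
... | n , pn , least = suc n , pn , λ where
  zero p₀ → contradiction p₀ ¬p₀
  (suc k) pk → s≤s (least k pk)

ℕ-floor : ∀ q → ℕtoℚ 0 ℚ.≤ q → ∃[ N ] ℕtoℚ N ℚ.≤ q × (∀ e → ℕtoℚ e ℚ.≤ q → e ℕ.≤ N)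
ℕ-floor q 0≤q =
  findGreatest (λ e → ℕtoℚ e ℚ.≤? q) ℤ.∣ ℚ.ℚ.numerator q ∣ 0≤q λ e → ℕtoℚ-≤-∣numerator∣ e q

edge-resp : ∀ {V : Set} (A : V → V → Bool) {x₁ x₂ y₁ y₂} → x₁ ≡ x₂ → y₁ ≡ y₂ →
  A x₁ y₁ ≡ true → A x₂ y₂ ≡ true
edge-resp A refl refl = id

module _ {V : Set} (A : V → V → Bool) where

  Pairwise : ∀ {s} → (Fin s → V) → Set
  Pairwise v = ∀ i j → i ≢ j → A (v i) (v j) ≡ true

  record Clique (P : V → Set) (s : ℕ) : Set where
    constructor clique
    field
      vertex   : Fin s → V
      inside   : ∀ i → P (vertex i)
      pairwise : Pairwise vertex

  CliqueBounded : (V → Set) → ℕ → Set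
  CliqueBounded P w = ∀ s → Clique P s → s ℕ.≤ w

  Neighbours : (V → Set) → V → V → Set
  Neighbours P x y = P y × A x y ≡ true

  pairwise-injective : ∀ {s} {v : Fin s → V} → (∀ x → A x x ≡ false) → Pairwise v →
    Injective _≡_ _≡_ v
  pairwise-injective {v = v} irr pw {i} {j} vi≡vj with i Fin.≟ j
  ... | yes i≡j = i≡j
  ... | no i≢j =
    contradiction (trans (≡.sym (irr (v i))) (edge-resp A refl (≡.sym vi≡vj) (pw i j i≢j))) λ ()

  Clique-cone : (∀ x y → A x y ≡ A y x) → ∀ {P x s} → P x → Clique (Neighbours P x) s →
    Clique P (suc s)
  Clique-cone A-sym {P} {x} px (clique v inside pw) =
    clique (x Vector.∷ v) inside₀ pairwise₀
    where
    inside₀ : ∀ i → P ((x Vector.∷ v) i)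
    inside₀ zero    = px
    inside₀ (suc i) = proj₁ (inside i)
    pairwise₀ : Pairwise (x Vector.∷ v)
    pairwise₀ zero    zero    0≢0   = contradiction refl 0≢0
    pairwise₀ zero    (suc j) _     = proj₂ (inside j)
    pairwise₀ (suc i) zero    _     = trans (A-sym (v i) x) (proj₂ (inside i))
    pairwise₀ (suc i) (suc j) si≢sj = pw i j (si≢sj ∘ cong suc)

  Clique-++ : (∀ x y → A x y ≡ A y x) → ∀ {P s t} (K : Clique P s) (L : Clique P t) →
    (∀ i j → A (Clique.vertex K i) (Clique.vertex L j) ≡ true) → Clique P (s + t)
  Clique-++ A-sym {P} {s} {t} (clique u u-inside u-pw) (clique v v-inside v-pw) cross =
    clique (uv ∘ splitAt s) (uv-inside ∘ splitAt s) λ i j i≢j →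
      uv-pairwise (splitAt s i) (splitAt s j) (i≢j ∘ splitAt-injective)
    where
    uv = [ u , v ]′
    uv-inside : ∀ x → P (uv x)
    uv-inside (inj₁ i) = u-inside i
    uv-inside (inj₂ j) = v-inside j
    splitAt-injective : ∀ {i j} → splitAt s i ≡ splitAt s j → i ≡ j
    splitAt-injective {i} {j} eq =
      trans (≡.sym (Fin.join-splitAt s t i)) (trans (cong (join s t) eq) (Fin.join-splitAt s t j))
    uv-pairwise : ∀ x y → x ≢ y → A (uv x) (uv y) ≡ true
    uv-pairwise (inj₁ i) (inj₁ j) x≢y = u-pw i j (x≢y ∘ cong inj₁)
    uv-pairwise (inj₁ i) (inj₂ j) _   = cross i j
    uv-pairwise (inj₂ i) (inj₁ j) _   = trans (A-sym (v i) (u j)) (cross j i)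
    uv-pairwise (inj₂ i) (inj₂ j) x≢y = v-pw i j (x≢y ∘ cong inj₂)

open Clique

Clique-map : ∀ {V W : Set} {A : V → V → Bool} {B : W → W → Bool} {P Q s} (φ : V → W) →
  (∀ {x} → P x → Q (φ x)) → (∀ {x y} → A x y ≡ true → B (φ x) (φ y) ≡ true) →
  Clique A P s → Clique B Q s
Clique-map φ P⇒Q A⇒B (clique v inside pw) =
  clique (φ ∘ v) (P⇒Q ∘ inside) λ i j i≢j → A⇒B (pw i j i≢j)

Clique⇒HasClique : ∀ {n} (G : Graph n) {P s} → Clique (adj G) P s → HasClique G s
Clique⇒HasClique G (clique v _ pw) = v , pairwise-injective (adj G) (irrefl G) pw , pw

Clique-empty : ∀ {V : Set} {A : V → V → Bool} {P} → Clique A P 0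
Clique-empty = clique (λ ()) (λ ()) (λ ())

Clique-singleton : ∀ {V : Set} {A : V → V → Bool} {P x} → P x → Clique A P 1
Clique-singleton {x = x} px = clique (λ _ → x) (λ _ → px) λ { zero zero 0≢0 → contradiction refl 0≢0 }

singleton-cliqueBounded : ∀ {n} (G : Graph n) v → CliqueBounded (adj G) (_≡ v) 1
singleton-cliqueBounded G v zero          _                   = z≤n
singleton-cliqueBounded G v (suc zero)    _                   = s≤s z≤n
singleton-cliqueBounded G v (suc (suc s)) (clique _ inside pw) =
  contradiction (pairwise-injective (adj G) (irrefl G) pw (trans (inside zero) (≡.sym (inside (suc zero)))))
    λ ()

∃-function? : ∀ a {b} {R : (Fin a → Fin b) → Set} → (∀ {f g} → f ≗ g → R f → R g) →
  Decidable R → Dec (∃ R)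
∃-function? zero {b} R-resp R? = map′ (empty ,_) (λ (f , r) → R-resp (λ ()) r) (R? empty)
  where
  empty : Fin 0 → Fin b
  empty ()
∃-function? (suc a) {R = R} R-resp R? =
  map′ (λ (x , g , r) → x Vector.∷ g , r)
       (λ (f , r) → Vector.head f , Vector.tail f , R-resp head∷tail r)
       (Fin.any? λ x → ∃-function? a (λ f≗g → R-resp (∷-cong x f≗g)) (R? ∘ (x Vector.∷_)))
  where
  head∷tail : ∀ {f} → f ≗ Vector.head f Vector.∷ Vector.tail f
  head∷tail zero    = refl
  head∷tail (suc i) = refl
  ∷-cong : ∀ x {f g : Fin a → _} → f ≗ g → (x Vector.∷ f) ≗ (x Vector.∷ g)
  ∷-cong x f≗g zero    = refl
  ∷-cong x f≗g (suc i) = f≗g i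

hasClique? : ∀ {n} (G : Graph n) s → Dec (HasClique G s)
hasClique? {n} G s =
  map′ (λ (v , pw) → Clique⇒HasClique G (clique v (λ _ → tt) pw)) (λ (v , _ , pw) → v , pw)
    (∃-function? s (λ u≗v pw i j i≢j → edge-resp (adj G) (u≗v i) (u≗v j) (pw i j i≢j))
      λ v → Fin.all? λ i → Fin.all? λ j → ¬? (i Fin.≟ j) →-dec (adj G (v i) (v j) Bool.≟ true))

colourable? : ∀ {n} (G : Graph n) k → Dec (Colourable G k)
colourable? {n} G k =
  ∃-function? n (λ c≗d proper i j ij di≡dj → proper i j ij (trans (c≗d i) (trans di≡dj (≡.sym (c≗d j)))))
    λ c → Fin.all? λ i → Fin.all? λ j → (adj G i j Bool.≟ true) →-dec ¬? (c i Fin.≟ c j)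

cliqueNumber : ∀ {n} (G : Graph n) → ∃ (IsCliqueNumber G)
cliqueNumber {n} G =
  findGreatest (hasClique? G) n ((λ ()) , (λ {i} → ⊥-elim (Fin.¬Fin0 i)) , λ ())
    λ k (_ , injective , _) → Fin.injective⇒≤ injective

chromaticNumber : ∀ {n} (G : Graph n) → ∃ (IsChromaticNumber G)
chromaticNumber {n} G =
  findLeast (colourable? G) n (id , λ i j ij i≡j → no-loop j (edge-resp (adj G) i≡j refl ij))
  where
  no-loop : ∀ i → adj G i i ≢ true
  no-loop i ii = contradiction (trans (≡.sym (irrefl G i)) ii) λ ()

record Enumeration {n} (P : Fin n → Set) : Set where
  field
    size              : ℕ
    element           : Fin size → Fin n
    element-injective : Injective _≡_ _≡_ element
    element-inside    : ∀ i → P (element i)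
    index             : ∀ {x} → P x → Fin size
    element-index     : ∀ {x} (px : P x) → element (index px) ≡ x

module _ {n} {P : Fin (suc n) → Set} where

  Enumeration-skip : ¬ P zero → Enumeration (P ∘ suc) → Enumeration P
  Enumeration-skip ¬p₀ E = record
    { size              = size
    ; element           = suc ∘ element
    ; element-injective = element-injective ∘ Fin.suc-injective
    ; element-inside    = element-inside
    ; index             = λ { {zero} p₀ → contradiction p₀ ¬p₀ ; {suc x} px → index px }
    ; element-index     = λ { {zero} p₀ → contradiction p₀ ¬p₀ ; {suc x} px → cong suc (element-index px) }
    }
    where open Enumeration E

  Enumeration-keep : P zero → Enumeration (P ∘ suc) → Enumeration P
  Enumeration-keep p₀ E = record
    { size              = suc size
    ; element           = zero Vector.∷ suc ∘ element
    ; element-injective = injective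
    ; element-inside    = λ { zero → p₀ ; (suc i) → element-inside i }
    ; index             = λ { {zero} _ → zero ; {suc x} px → suc (index px) }
    ; element-index     = λ { {zero} _ → refl ; {suc x} px → cong suc (element-index px) }
    }
    where
    open Enumeration E
    injective : Injective _≡_ _≡_ (zero Vector.∷ suc ∘ element)
    injective {zero}  {zero}  _  = refl
    injective {suc i} {suc j} eq = cong suc (element-injective (Fin.suc-injective eq))

enumerate : ∀ {n} {P : Fin n → Set} → Decidable P → Enumeration P
enumerate {zero} P? = record
  { size              = 0
  ; element           = λ ()
  ; element-injective = λ {i} → ⊥-elim (Fin.¬Fin0 i)
  ; element-inside    = λ ()
  ; index             = λ {x} _ → ⊥-elim (Fin.¬Fin0 x)
  ; element-index     = λ {x} _ → ⊥-elim (Fin.¬Fin0 x)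
  }
enumerate {suc n} P? with P? zero
... | yes p₀ = Enumeration-keep p₀ (enumerate (P? ∘ suc))
... | no ¬p₀ = Enumeration-skip ¬p₀ (enumerate (P? ∘ suc))

induced : ∀ {n k} → Graph n → (Fin k → Fin n) → Graph k
induced G e = record
  { adj    = λ i j → adj G (e i) (e j)
  ; sym    = λ i j → sym G (e i) (e j)
  ; irrefl = irrefl G ∘ e
  }

record SubsetColouring {V : Set} (A : V → V → Bool) (P : V → Set) (k : ℕ) : Set where
  field
    colour : ∀ {x} → P x → Fin k
    proper : ∀ {x y} (px : P x) (py : P y) → A x y ≡ true → colour px ≢ colour py

SubsetColouring-≤ : ∀ {V : Set} {A : V → V → Bool} {P k l} → k ℕ.≤ l →
  SubsetColouring A P k → SubsetColouring A P l
SubsetColouring-≤ k≤l C = record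
  { colour = λ px → inject≤ (colour px) k≤l
  ; proper = λ px py xy → proper px py xy ∘ Fin.inject≤-injective k≤l k≤l _ _
  }
  where open SubsetColouring C

range-cliqueBounded : ∀ {m n} {H : Graph m} {G : Graph n} {w} (ι : Fin m → Fin n) →
  (∀ i j → adj H i j ≡ adj G (ι i) (ι j)) → IsCliqueNumber H w →
  CliqueBounded (adj G) (λ x → ∃[ i ] ι i ≡ x) w
range-cliqueBounded {H = H} {G} ι ι-adj (_ , ω-max) s (clique v inside pw) =
  ω-max s (Clique⇒HasClique H (clique preimage (λ _ → tt) λ i j i≢j →
    trans (ι-adj (preimage i) (preimage j))
      (edge-resp (adj G) (≡.sym (proj₂ (inside i))) (≡.sym (proj₂ (inside j))) (pw i j i≢j))))
  where
  preimage : Fin s → Fin _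
  preimage i = proj₁ (inside i)

range-colourable : ∀ {m n k} {H : Graph m} {G : Graph n} (ι : Fin m → Fin n) →
  (∀ i j → adj H i j ≡ adj G (ι i) (ι j)) → SubsetColouring (adj G) (λ x → ∃[ i ] ι i ≡ x) k →
  Colourable H k
range-colourable {G = G} ι ι-adj C =
  (λ i → colour (i , refl)) , λ i j ij → proper (i , refl) (j , refl) (trans (≡.sym (ι-adj i j)) ij)
  where open SubsetColouring C

data Apart {C : Set} : List C → List C → Set where
  here  : ∀ {x y xs ys} → x ≢ y → Apart (x ∷ xs) (y ∷ ys)
  there : ∀ {x y xs ys} → Apart xs ys → Apart (x ∷ xs) (y ∷ ys)

Apart-++ : ∀ {C : Set} {xs ys : List C} zs ws → Apart xs ys → Apart (xs ++ zs) (ys ++ ws)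
Apart-++ zs ws (here x≢y)  = here x≢y
Apart-++ zs ws (there xs#ys) = there (Apart-++ zs ws xs#ys)

Apart-prefix : ∀ {C : Set} {xs ys : List C} zs → Apart xs ys → Apart (zs ++ xs) (zs ++ ys)
Apart-prefix []       xs#ys = xs#ys
Apart-prefix (z ∷ zs) xs#ys = there (Apart-prefix zs xs#ys)

record ListColouring {V : Set} (A : V → V → Bool) (P : V → Set) (N : ℕ) : Set where
  field
    colours         : V → List (Fin N)
    apart           : ∀ {x y} → P x → P y → A x y ≡ true → Apart (colours x) (colours y)
    neighbourClique : ∀ {x} → P x → Clique A (Neighbours A P x) (length (colours x))

ListColourable : ∀ {V : Set} → ℕ → ℕ → (V → V → Bool) → Set₁
ListColourable {V} w N A = ∀ (P : V → Set) → Decidable P → CliqueBounded A P w → ListColouring A P N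

encode : ∀ {N} w → List (Fin (suc N)) → Fin (suc N ℕ.^ w)
encode zero    _ = zero
encode {N} (suc w) [] = combine (zero {N}) (encode w [])
encode (suc w) (x ∷ xs) = combine x (encode w xs)

encode-apart : ∀ {N} w {xs ys : List (Fin (suc N))} → length xs ℕ.≤ w → length ys ℕ.≤ w →
  Apart xs ys → encode w xs ≢ encode w ys
encode-apart {N} (suc w) {x ∷ xs} {y ∷ ys} _ _ (here x≢y) =
  x≢y ∘ Fin.combine-injectiveˡ {suc N} x (encode w xs) y (encode w ys)
encode-apart {N} (suc w) {x ∷ xs} {y ∷ ys} (s≤s xs≤w) (s≤s ys≤w) (there xs#ys) =
  encode-apart w xs≤w ys≤w xs#ys ∘ Fin.combine-injectiveʳ {suc N} x (encode w xs) y (encode w ys)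

ListColouring⇒SubsetColouring : ∀ {V : Set} {A : V → V → Bool} {P N w} → (∀ x y → A x y ≡ A y x) →
  CliqueBounded A P w → ListColouring A P (suc N) → SubsetColouring A P (suc N ℕ.^ w)
ListColouring⇒SubsetColouring {A = A} {P} {w = w} A-sym bounded L = record
  { colour = λ {x} _ → encode w (colours x)
  ; proper = λ px py xy → encode-apart w (length≤w px) (length≤w py) (apart px py xy)
  }
  where
  open ListColouring L
  length≤w : ∀ {x} → P x → length (colours x) ℕ.≤ w
  length≤w px = ℕ.<⇒≤ (bounded _ (Clique-cone A A-sym px (neighbourClique px)))

mkSumGraph-listColourable : ∀ {n m w N} {A : Fin n ⊎ Fin m → Fin n ⊎ Fin m → Bool} s r →
  ListColourable w N A → ListColourable w N (adj (mkSumGraph n m A s r))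
mkSumGraph-listColourable {n} {m} {A = A} s r colourable P P? bounded = record
  { colours         = colours ∘ splitAt n
  ; apart           = λ pi pj → apart (unsplit pi) (unsplit pj)
  ; neighbourClique = λ pi → Clique-map (join n m) (λ (py , xy) → py , adj-resplitʳ xy) adj-resplit
                               (neighbourClique (unsplit pi))
  }
  where
  adj-resplit : ∀ {x y} → A x y ≡ true → A (splitAt n (join n m x)) (splitAt n (join n m y)) ≡ true
  adj-resplit {x} {y} = edge-resp A (≡.sym (Fin.splitAt-join n m x)) (≡.sym (Fin.splitAt-join n m y))
  adj-resplitʳ : ∀ {x y} → A x y ≡ true → A x (splitAt n (join n m y)) ≡ true
  adj-resplitʳ {x} {y} = edge-resp A refl (≡.sym (Fin.splitAt-join n m y))
  unsplit : ∀ {i} → P i → P (join n m (splitAt n i))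
  unsplit {i} = ≡.subst P (≡.sym (Fin.join-splitAt n m i))
  open ListColouring (colourable (P ∘ join n m) (P? ∘ join n m)
                        λ t K → bounded t (Clique-map (join n m) id adj-resplit K))

union-listColourable : ∀ {n m w N} {G : Graph n} {H : Graph m} →
  ListColourable w N (adj G) → ListColourable w N (adj H) → ListColourable w N (unionAdj G H)
union-listColourable {G = G} {H} G-colourable H-colourable P P? bounded = record
  { colours         = [ colours₁ , colours₂ ]′
  ; apart           = λ { {inj₁ a} {inj₁ b} → apart₁ ; {inj₂ a} {inj₂ b} → apart₂
                        ; {inj₁ a} {inj₂ b} _ _ () ; {inj₂ a} {inj₁ b} _ _ () }
  ; neighbourClique = λ { {inj₁ a} pa → Clique-map inj₁ id id (neighbourClique₁ pa)
                        ; {inj₂ b} pb → Clique-map inj₂ id id (neighbourClique₂ pb) }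
  }
  where
  open ListColouring (G-colourable (P ∘ inj₁) (P? ∘ inj₁) λ s K → bounded s (Clique-map inj₁ id id K))
    renaming (colours to colours₁; apart to apart₁; neighbourClique to neighbourClique₁)
  open ListColouring (H-colourable (P ∘ inj₂) (P? ∘ inj₂) λ s K → bounded s (Clique-map inj₂ id id K))
    renaming (colours to colours₂; apart to apart₂; neighbourClique to neighbourClique₂)

module Substitution {k m} (G₁ : Graph (suc k)) (u : Fin (suc k)) (G₂ : Graph m) where

  A : Fin k ⊎ Fin m → Fin k ⊎ Fin m → Bool
  A = substAdj G₁ u G₂

  contract : Fin k ⊎ Fin m → Fin (suc k)
  contract (inj₁ a) = punchIn u a
  contract (inj₂ _) = u

  adj-lift : ∀ x y → adj G₁ (contract x) (contract y) ≡ true → A x y ≡ true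
  adj-lift (inj₁ a) (inj₁ b) = id
  adj-lift (inj₁ a) (inj₂ b) = id
  adj-lift (inj₂ a) (inj₁ b) = id
  adj-lift (inj₂ a) (inj₂ b) uu = contradiction (trans (≡.sym (irrefl G₁ u)) uu) λ ()

  Image : (Fin k ⊎ Fin m → Set) → Fin (suc k) → Set
  Image P v = ∃[ x ] P x × contract x ≡ v

  image? : ∀ {P} → Decidable P → Decidable (Image P)
  image? P? v = map′ [ (λ (a , q) → inj₁ a , q) , (λ (b , q) → inj₂ b , q) ]′ split
    (Fin.any? (λ a → P? (inj₁ a) ×-dec (contract (inj₁ a) Fin.≟ v)) ⊎-dec
     Fin.any? (λ b → P? (inj₂ b) ×-dec (contract (inj₂ b) Fin.≟ v)))
    where
    split : ∀ {Q : Fin k ⊎ Fin m → Set} → ∃ Q → ∃ (Q ∘ inj₁) ⊎ ∃ (Q ∘ inj₂)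
    split (inj₁ a , q) = inj₁ (a , q)
    split (inj₂ b , q) = inj₂ (b , q)

  lift-clique : ∀ {P Q s} → Clique (adj G₁) (λ v → Image P v × Q v) s →
    Clique A (λ x → P x × Q (contract x)) s
  lift-clique {P} {Q} {s} (clique v inside pw) = clique preimage preimage-inside λ i j i≢j →
    adj-lift (preimage i) (preimage j)
      (edge-resp (adj G₁) (≡.sym (contract-preimage i)) (≡.sym (contract-preimage j)) (pw i j i≢j))
    where
    preimage : Fin s → Fin k ⊎ Fin m
    preimage i = proj₁ (proj₁ (inside i))
    contract-preimage : ∀ i → contract (preimage i) ≡ v i
    contract-preimage i = proj₂ (proj₂ (proj₁ (inside i)))
    preimage-inside : ∀ i → P (preimage i) × Q (contract (preimage i))
    preimage-inside i =
      proj₁ (proj₂ (proj₁ (inside i))) , ≡.subst Q (≡.sym (contract-preimage i)) (proj₂ (inside i))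

  listColourable : ∀ {w N} → ListColourable w N (adj G₁) → ListColourable w N (adj G₂) →
    ListColourable w N A
  listColourable {w} {N} G₁-colourable G₂-colourable P P? bounded = record
    { colours         = colours
    ; apart           = apart
    ; neighbourClique = neighbourClique
    }
    where
    open ListColouring (G₁-colourable (Image P) (image? P?) λ s K →
                          bounded s (Clique-map id proj₁ id (lift-clique (Clique-map id (_, tt) id K))))
      renaming (colours to colours₁; apart to apart₁; neighbourClique to neighbourClique₁)
    open ListColouring (G₂-colourable (P ∘ inj₂) (P? ∘ inj₂) λ s K → bounded s (Clique-map inj₂ id id K))
      renaming (colours to colours₂; apart to apart₂; neighbourClique to neighbourClique₂)

    image : ∀ {x} → P x → Image P (contract x)
    image px = _ , px , refl

    inner : Fin k ⊎ Fin m → List (Fin N)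
    inner (inj₁ _) = []
    inner (inj₂ b) = colours₂ b

    colours : Fin k ⊎ Fin m → List (Fin N)
    colours x = colours₁ (contract x) ++ inner x

    apart : ∀ {x y} → P x → P y → A x y ≡ true → Apart (colours x) (colours y)
    apart {inj₁ a} {inj₁ b} pa pb ab = Apart-++ [] [] (apart₁ (image pa) (image pb) ab)
    apart {inj₁ a} {inj₂ b} pa pb ab = Apart-++ [] (colours₂ b) (apart₁ (image pa) (image pb) ab)
    apart {inj₂ a} {inj₁ b} pa pb ab = Apart-++ (colours₂ a) [] (apart₁ (image pa) (image pb) ab)
    apart {inj₂ a} {inj₂ b} pa pb ab = Apart-prefix (colours₁ u) (apart₂ pa pb ab)

    outer-clique : ∀ {x} → P x → Clique A (λ y → P y × adj G₁ (contract x) (contract y) ≡ true)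
                                     (length (colours₁ (contract x)))
    outer-clique px = lift-clique (neighbourClique₁ (image px))

    inner-clique : ∀ {x} → P x → Clique A (Neighbours A P x) (length (inner x))
    inner-clique {inj₁ a} _  = Clique-empty
    inner-clique {inj₂ b} pb = Clique-map inj₂ id id (neighbourClique₂ pb)

    cross : ∀ {x} (px : P x) i j →
      A (vertex (outer-clique px) i) (vertex (inner-clique px) j) ≡ true
    cross {inj₂ b} pb i j = adj-lift (vertex (outer-clique pb) i) (vertex (inner-clique pb) j)
      (trans (sym G₁ _ u) (proj₂ (inside (outer-clique pb) i)))

    neighbourClique : ∀ {x} → P x → Clique A (Neighbours A P x) (length (colours x))
    neighbourClique {x} px =
      ≡.subst (Clique A (Neighbours A P x)) (≡.sym (length-++ (colours₁ (contract x))))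
        (Clique-++ A (substSym G₁ u G₂)
          (Clique-map id (λ {y} (py , xy) → py , adj-lift x y xy) id (outer-clique px))
          (inner-clique px) (cross px))

SubsetColouring⇒ListColouring : ∀ {n N} (G : Graph n) {P} → Decidable P →
  SubsetColouring (adj G) P N → ListColouring (adj G) P N
SubsetColouring⇒ListColouring {n} {N} G {P} P? C =
  record { colours = colours ; apart = apart ; neighbourClique = neighbourClique }
  where
  open SubsetColouring C
  neighbour? : ∀ x → Dec (∃ (Neighbours (adj G) P x))
  neighbour? x = Fin.any? λ y → P? y ×-dec (adj G x y Bool.≟ true)
  -- A vertex with no neighbour in P has no 1-clique in its neighbourhood, so it gets [ ].
  colour-list : ∀ {x} → Dec (P x) → Dec (∃ (Neighbours (adj G) P x)) → List (Fin N)
  colour-list (yes px) (yes _) = [ colour px ]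
  colour-list _        _       = []
  colours : Fin n → List (Fin N)
  colours x = colour-list (P? x) (neighbour? x)
  apart : ∀ {x y} → P x → P y → adj G x y ≡ true → Apart (colours x) (colours y)
  apart {x} {y} px py xy with P? x | neighbour? x | P? y | neighbour? y
  ... | yes px₀ | yes _ | yes py₀ | yes _ = here (proper px₀ py₀ xy)
  ... | no ¬px  | _     | _       | _     = contradiction px ¬px
  ... | _       | no ¬n | _       | _     = contradiction (y , py , xy) ¬n
  ... | _       | _     | no ¬py  | _     = contradiction py ¬py
  ... | _       | _     | _       | no ¬n = contradiction (x , px , trans (sym G y x) xy) ¬n
  neighbourClique : ∀ {x} → P x → Clique (adj G) (Neighbours (adj G) P x) (length (colours x))
  neighbourClique {x} px with P? x | neighbour? x
  ... | yes _  | yes (_ , y-near) = Clique-singleton y-near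
  ... | yes _  | no _             = Clique-empty
  ... | no ¬px | _                = contradiction px ¬px

Closure-vertex : ∀ {𝒢 : Class} {n} {G : Graph n} → Closure 𝒢 G → Fin n →
  ∃[ n₀ ] Σ (Graph n₀) λ G₀ → 𝒢 G₀ × Fin n₀
Closure-vertex (base {G = G} g) v = _ , G , g , v
Closure-vertex (union {n} cG cH) v with splitAt n v
... | inj₁ a = Closure-vertex cG a
... | inj₂ b = Closure-vertex cH b
Closure-vertex (subst u cG₁ cG₂) v = Closure-vertex cG₁ u

module _ {𝒢 : Class} {f : ℕ → ℚ} (f-mono : NonDecreasing f) (𝒢-bounded : ChiBoundedBy 𝒢 f) where

  member-subsetColourable : ∀ {n} {G : Graph n} → 𝒢 G → ∀ {P} → Decidable P →
    ∀ {w} → CliqueBounded (adj G) P w → ∃[ χ ] ℕtoℚ χ ℚ.≤ f w × SubsetColouring (adj G) P χ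
  member-subsetColourable {G = G} g {P} P? {w} bounded =
    colour-enumerated (cliqueNumber H) (chromaticNumber H)
    where
    open Enumeration (enumerate P?)
    H : Graph size
    H = induced G element
    colour-enumerated : ∃ (IsCliqueNumber H) → ∃ (IsChromaticNumber H) →
      ∃[ χ ] ℕtoℚ χ ℚ.≤ f w × SubsetColouring (adj G) P χ
    colour-enumerated (ω , ω-is@((v , _ , pw) , _)) (χ , χ-is@((c , c-proper) , _)) =
      χ , χ≤fw , record
        { colour = λ px → c (index px)
        ; proper = λ px py xy → c-proper (index px) (index py)
            (edge-resp (adj G) (≡.sym (element-index px)) (≡.sym (element-index py)) xy)
        }
      where
      ω≤w : ω ℕ.≤ w
      ω≤w = bounded ω (clique (element ∘ v) (element-inside ∘ v) pw)
      χ≤fw : ℕtoℚ χ ℚ.≤ f w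
      χ≤fw = ℚ.≤-trans (𝒢-bounded G g H (element , element-injective , λ _ _ → refl) ω χ ω-is χ-is)
                       (f-mono ω w ω≤w)

  member-listColourable : ∀ {n} {G : Graph n} → 𝒢 G → ∀ {w N} →
    (∀ e → ℕtoℚ e ℚ.≤ f w → e ℕ.≤ N) → ListColourable w N (adj G)
  member-listColourable {G = G} g N-max P P? bounded =
    let χ , χ≤fw , C = member-subsetColourable g P? bounded
    in SubsetColouring⇒ListColouring G P? (SubsetColouring-≤ (N-max χ χ≤fw) C)

  closure-listColourable : ∀ {n} {G : Graph n} → Closure 𝒢 G → ∀ {w N} →
    (∀ e → ℕtoℚ e ℚ.≤ f w → e ℕ.≤ N) → ListColourable w N (adj G)
  closure-listColourable (base g) N-max = member-listColourable g N-max
  closure-listColourable (union {G = G} {H} cG cH) N-max =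
    mkSumGraph-listColourable (unionSym G H) (unionIrr G H)
      (union-listColourable (closure-listColourable cG N-max) (closure-listColourable cH N-max))
  closure-listColourable (subst {G₁ = G₁} {G₂} u cG₁ cG₂) N-max =
    mkSumGraph-listColourable (substSym G₁ u G₂) (substIrr G₁ u G₂)
      (Substitution.listColourable G₁ u G₂
        (closure-listColourable cG₁ N-max) (closure-listColourable cG₂ N-max))

  closure-subsetColourable : ∀ {n} {G : Graph n} → Closure 𝒢 G → ∀ {P} → Decidable P →
    ∀ {w N} → CliqueBounded (adj G) P w → (∀ e → ℕtoℚ e ℚ.≤ f w → e ℕ.≤ N) → 1 ℕ.≤ N →
    SubsetColouring (adj G) P (N ℕ.^ w)
  closure-subsetColourable {G = G} cG {P} P? {N = suc _} bounded N-max _ =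
    ListColouring⇒SubsetColouring (sym G) bounded (closure-listColourable cG N-max P P? bounded)

  -- Makes N ≥ 1, which the padding in encode needs.
  closure-one≤f : ∀ {n} {G : Graph n} → Closure 𝒢 G → Fin n → ∀ {w} → 1 ℕ.≤ w → ℕtoℚ 1 ℚ.≤ f w
  closure-one≤f cG v 1≤w =
    let _ , G₀ , g₀ , v₀ = Closure-vertex cG v
        χ , χ≤fw , C = member-subsetColourable g₀ (Fin._≟ v₀)
                         (λ s K → ℕ.≤-trans (singleton-cliqueBounded G₀ v₀ s K) 1≤w)
    in ℚ.≤-trans (ℕtoℚ-mono-≤ (ℕ.≤-trans (s≤s z≤n) (Fin.toℕ<n (SubsetColouring.colour C refl)))) χ≤fw

theorem2p2 : (𝒢 : Class) (f : ℕ → ℚ) → NonDecreasing f → ChiBoundedBy 𝒢 f →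
    ChiBoundedBy (Closure 𝒢) (λ k → f k ^ k)
theorem2p2 𝒢 f f-mono 𝒢-bounded G cG {zero} H _ w c ((_ , ω-injective , _) , _) (_ , χ-least)
  with Fin.injective⇒≤ ω-injective | χ-least 0 ((λ ()) , λ ())
... | z≤n | z≤n = ℕtoℚ-mono-≤ {0} {1} z≤n
theorem2p2 𝒢 f f-mono 𝒢-bounded G cG {suc m} H (ι , _ , ι-adj) w c ω-is (_ , χ-least) =
  bound (ℕ-floor (f w) (ℚ.≤-trans (ℕtoℚ-mono-≤ {0} {1} z≤n) 1≤fw))
  where
  1≤w : 1 ℕ.≤ w
  1≤w = proj₂ ω-is 1 (Clique⇒HasClique H (Clique-singleton {P = λ _ → ⊤} {x = zero} tt))
  1≤fw : ℕtoℚ 1 ℚ.≤ f w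
  1≤fw = closure-one≤f f-mono 𝒢-bounded cG (ι zero) 1≤w
  bound : ∃[ N ] ℕtoℚ N ℚ.≤ f w × (∀ e → ℕtoℚ e ℚ.≤ f w → e ℕ.≤ N) → ℕtoℚ c ℚ.≤ f w ^ w
  bound (N , N≤fw , N-max) =
    ℚ.≤-trans (ℕtoℚ-mono-≤ (χ-least (N ℕ.^ w) (range-colourable {H = H} {G} ι ι-adj range-colouring)))
              (ℕtoℚ-^-≤ w N≤fw)
    where
    range-colouring : SubsetColouring (adj G) (λ x → ∃[ i ] ι i ≡ x) (N ℕ.^ w)
    range-colouring = closure-subsetColourable f-mono 𝒢-bounded cG (λ x → Fin.any? λ i → ι i Fin.≟ x)
                        (range-cliqueBounded {H = H} {G} ι ι-adj ω-is) N-max (N-max 1 1≤fw)
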